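{- Let $\mathcal{U}=(V,E,F,s,\Sigma)$ be the union automaton of two Wheeler automata, and suppose the iterative refining algorithm applied to $\mathcal{U}$ terminates without reporting failure, with final ordered partition $P_0,\dots,P_k$ (a W-consistent partition that cannot be further refined). Let $\mathcal{U}'=(V',E',F',P_0,\Sigma)$ with $V'=\{P_0,\dots,P_k\}$, $(P_i,P_j,a)\in E'$ iff $(v,v',a)\in E$ for some $v\in P_i$, $v'\in P_j$, and $P_i\in F'$ iff $P_i\cap F\ne\emptyset$. Then $\mathcal{U}'$ recognizes the same language as $\mathcal{U}$.
   Context: Wheeler graph: a directed edge-labeled graph with a node ordering such that in-degree-$0$ nodes come first and for edges $(u,v)$ labeled $a$, $(u',v')$ labeled $a'$: $a<a'\Rightarrow v<v'$ and $(a=a')\wedge(u<u')\Rightarrow v\le v'$. NFA $(V,E,F,s,\Sigma)$, $\Sigma=\{1,\dots,\sigma\}$, $E\subseteq V\times V\times\Sigma$, $s$ the only state of in-degree $0$, all states reachable from $s$ and able to reach a final state. Wheeler automaton: NFA without $\epsilon$-transitions with a fixed state ordering making its state diagram a Wheeler graph. For Wheeler automata $\mathcal{A}_b=(V_b,E_b,F_b,s_b,\Sigma)$, $b=0,1$, with disjoint state sets, the union automaton has $V=(V_0\setminus\{s_0\})\cup(V_1\setminus\{s_1\})\cup\{s\}$, $E=E_0^*\cup E_1^*$ ($E_b$ with edges leaving $s_b$ redirected to leave $s$), $F=(F_0\setminus\{s_0\})\cup(F_1\setminus\{s_1\})$ plus $s$ if $s_0\in F_0$ or $s_1\in F_1$.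 A Wheeler C-order is an ordering of $V$ making $\mathcal{U}$ a Wheeler graph and preserving the relative orders of $V_0\setminus\{s_0\}$ and $V_1\setminus\{s_1\}$. An ordered partition $P_0,\dots,P_k$ of $V$ is W-consistent if $x\in P_i$, $y\in P_j$, $i<j$ implies $x<y$ in every Wheeler C-order. For $v\ne s$, $\lambda(v)$ is the label of the edges entering $v$. Iterative refining algorithm: the initial ordered partition is $P_0=\{s\}$, $P_c=\{v:\lambda(v)=c\}$, $c=1,\dots,\sigma$ (empty sets discarded). Given the current ordered partition $P_0,\dots,P_k$, the minmax pair of $v\ne s$ is $(\ell,m)$ with $\ell$ (resp. $m$) the smallest (resp. largest) index $t$ such that an edge enters $v$ from a node of $P_t$. Pairs $(\ell,m),(\ell',m')$ are compatible if $m\le\ell'$ or $m'\le\ell$; $(\ell,m)\preceq(\ell',m')$ means $m\le\ell'$. A refinement step: for each $i=1,\dots,k$, list $S_0=P_i\cap V_0$ in increasing $\mathcal{A}_0$-order and $S_1=P_i\cap V_1$ in increasing $\mathcal{A}_1$-order and merge them into a list $L$: while both are nonempty, compare their first elements $v\in S_0$, $v'\in S_1$ with minmax pairs $(\ell,m),(\ell',m')$; if incompatible, the algorithm stops reporting that no Wheeler C-order exists; if $(\ell,m)\preceq(\ell',m')$ move $v$ to the end of $L$, else move $v'$; then append the remaining elements. Split $L$ into maximal runs of consecutive nodes with identical minmax pairs. The new ordered partition is $P_0$ followed by the runs from $P_1$, then from $P_2$, ..., then from $P_k$. Steps are repeated until failure or until a step leaves the partition unchanged; in the latter case that partition is the final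 one. -}

module Defs where

open import Data.Nat as ℕ using (ℕ; zero; suc; _≤_; _⊓_; _⊔_; _≤?_)
open import Data.Fin as Fin using (Fin) renaming (zero to fzero; suc to fsuc)
open import Data.Fin.Properties using () renaming (_≟_ to _≟ᶠ_)
open import Data.List using (List; []; _∷_; _++_; map; filter; lookup; length; _∷ʳ_; head; foldr; allFin)
open import Data.List.Membership.Propositional using (_∈_)
import Data.List.Membership.DecPropositional as DecMem
open import Data.List.Relation.Binary.Permutation.Propositional using (_↭_)
open import Data.List.Relation.Binary.Pointwise using (Pointwise)
open import Data.Maybe as Maybe using (Maybe; just; nothing; _>>=_)
import Data.Maybe.Properties as MaybeP
import Data.Product.Properties as ProdP
open import Data.Product using (_×_; _,_; ∃-syntax; proj₁; proj₂)
open import Data.Sum using (_⊎_; inj₁; inj₂)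
open import Data.Bool using (Bool; true; false; _∨_; if_then_else_)
open import Relation.Nullary.Decidable using (⌊_⌋)
open import Relation.Binary.PropositionalEquality using (_≡_; refl)
open import Relation.Nullary using (¬_; Dec; yes; no)
open import Relation.Binary.Construct.Closure.ReflexiveTransitive using (Star)
open import Relation.Binary.Definitions using (DecidableEquality)
open import Function.Bundles using (_⇔_)

-- Alphabet Σ = {1,…,σ} is represented by Fin σ (label c+1 ↦ c), same order.
-- A Wheeler automaton has states Fin (suc n), the fixed Wheeler ordering
-- being the order of Fin, and start state s = fzero (the minimum; forced,
-- since in-degree-0 states come first and s is the only one).

Edge : ℕ → ℕ → Set
Edge m σ = Fin m × Fin m × Fin σ

record WA (σ : ℕ) : Set where
  field
    n     : ℕ
    edges : List (Edge (suc n) σ)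
    final : Fin (suc n) → Bool

  State : Set
  State = Fin (suc n)

  start : State
  start = fzero

module _ {σ : ℕ} (A : WA σ) where
  open WA A

  Step : State → State → Set
  Step u v = ∃[ a ] ((u , v , a) ∈ edges)

  InDeg0 : State → Set
  InDeg0 v = ∀ u a → ¬ ((u , v , a) ∈ edges)

  record IsWheelerGraph : Set where
    field
      indeg0-first   : ∀ u v → InDeg0 u → ¬ InDeg0 v → u Fin.< v
      wheeler-label  : ∀ {u v a u' v' a'} → (u , v , a) ∈ edges →
                       (u' , v' , a') ∈ edges → a Fin.< a' → v Fin.< v'
      wheeler-source : ∀ {u v a u' v'} → (u , v , a) ∈ edges →
                       (u' , v' , a) ∈ edges → u Fin.< u' → v Fin.≤ v'

  record IsWheelerAutomaton : Set where
    field
      start-indeg0 : InDeg0 start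
      only-indeg0  : ∀ v → InDeg0 v → v ≡ start
      reachable    : ∀ v → Star Step start v
      coreachable  : ∀ v → ∃[ f ] (final f ≡ true × Star Step v f)
      wheeler      : IsWheelerGraph

data Accepts {σ : ℕ} {S : Set} (E : S → S → Fin σ → Set) (F : S → Set) :
             S → List (Fin σ) → Set where
  acc-nil  : ∀ {q} → F q → Accepts E F q []
  acc-cons : ∀ {q q' a w} → E q q' a → Accepts E F q' w → Accepts E F q (a ∷ w)

module Union {σ : ℕ} (A₀ A₁ : WA σ) where
  private
    module A₀ = WA A₀
    module A₁ = WA A₁

  -- V = (V₀ \ {s₀}) ∪ (V₁ \ {s₁}) ∪ {s};  l i ↔ state fsuc i of A₀, r j ↔ fsuc j of A₁
  data UV : Set where
    s : UV
    l : Fin A₀.n → UV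
    r : Fin A₁.n → UV

  _≟ᵤ_ : DecidableEquality UV
  s ≟ᵤ s = yes refl
  s ≟ᵤ l _ = no λ ()
  s ≟ᵤ r _ = no λ ()
  l _ ≟ᵤ s = no λ ()
  l i ≟ᵤ l j with i ≟ᶠ j
  ... | yes refl = yes refl
  ... | no ne = no λ { refl → ne refl }
  l _ ≟ᵤ r _ = no λ ()
  r _ ≟ᵤ s = no λ ()
  r _ ≟ᵤ l _ = no λ ()
  r i ≟ᵤ r j with i ≟ᶠ j
  ... | yes refl = yes refl
  ... | no ne = no λ { refl → ne refl }

  open DecMem _≟ᵤ_ using (_∈?_)

  -- s_b ↦ s (redirects the edges leaving s_b to leave s)
  emb₀ : Fin (suc A₀.n) → UV
  emb₀ fzero = s
  emb₀ (fsuc i) = l i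

  emb₁ : Fin (suc A₁.n) → UV
  emb₁ fzero = s
  emb₁ (fsuc i) = r i

  edgesU : List (UV × UV × Fin σ)
  edgesU = map (λ e → emb₀ (proj₁ e) , emb₀ (proj₁ (proj₂ e)) , proj₂ (proj₂ e)) A₀.edges
        ++ map (λ e → emb₁ (proj₁ e) , emb₁ (proj₁ (proj₂ e)) , proj₂ (proj₂ e)) A₁.edges

  finalU : UV → Bool
  finalU s = A₀.final fzero ∨ A₁.final fzero
  finalU (l i) = A₀.final (fsuc i)
  finalU (r j) = A₁.final (fsuc j)

  EU : UV → UV → Fin σ → Set
  EU u v a = (u , v , a) ∈ edgesU

  FU : UV → Set
  FU v = finalU v ≡ true

  LangU : List (Fin σ) → Set
  LangU w = Accepts EU FU s w

  nonStart : List UV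
  nonStart = map l (allFin A₀.n) ++ map r (allFin A₁.n)

  edgesInto : UV → List (UV × UV × Fin σ)
  edgesInto v = filter (λ e → proj₁ (proj₂ e) ≟ᵤ v) edgesU

  λᵤ : UV → Maybe (Fin σ)
  λᵤ v = head (map (λ e → proj₂ (proj₂ e)) (edgesInto v))

  Partition : Set
  Partition = List (List UV)

  dropEmpty : Partition → Partition
  dropEmpty [] = []
  dropEmpty ([] ∷ Bs) = dropEmpty Bs
  dropEmpty ((x ∷ xs) ∷ Bs) = (x ∷ xs) ∷ dropEmpty Bs

  initial : Partition
  initial = (s ∷ []) ∷ dropEmpty
    (map (λ c → filter (λ v → MaybeP.≡-dec _≟ᶠ_ (λᵤ v) (just c)) nonStart) (allFin σ))

  blockOf : Partition → UV → ℕ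
  blockOf [] u = 0
  blockOf (B ∷ Bs) u with u ∈? B
  ... | yes _ = 0
  ... | no _ = suc (blockOf Bs u)

  -- minmax pair of v (v ≠ s; every such v has an incoming edge)
  minmax : Partition → UV → ℕ × ℕ
  minmax P v with map (λ e → blockOf P (proj₁ e)) (edgesInto v)
  ... | [] = 0 , 0
  ... | x ∷ xs = foldr _⊓_ x xs , foldr _⊔_ x xs

  Compatible : ℕ × ℕ → ℕ × ℕ → Set
  Compatible (ℓ , m) (ℓ' , m') = m ≤ ℓ' ⊎ m' ≤ ℓ

  compatible? : ∀ p q → Dec (Compatible p q)
  compatible? (ℓ , m) (ℓ' , m') with m ≤? ℓ' | m' ≤? ℓ
  ... | yes a | _ = yes (inj₁ a)
  ... | no _ | yes b = yes (inj₂ b)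
  ... | no a | no b = no λ { (inj₁ x) → a x ; (inj₂ y) → b y }

  _⪯_ : ℕ × ℕ → ℕ × ℕ → Set
  (ℓ , m) ⪯ (ℓ' , m') = m ≤ ℓ'

  _⪯?_ : ∀ p q → Dec (p ⪯ q)
  (ℓ , m) ⪯? (ℓ' , m') = m ≤? ℓ'

  _≟ₚ_ : DecidableEquality (ℕ × ℕ)
  _≟ₚ_ = ProdP.≡-dec ℕ._≟_ ℕ._≟_

  -- merging S₀ and S₁ (nothing = failure)
  merge : Partition → List (Fin A₀.n) → List (Fin A₁.n) → Maybe (List UV)
  merge P [] ys = just (map r ys)
  merge P (x ∷ xs) [] = just (map l (x ∷ xs))
  merge P (x ∷ xs) (y ∷ ys) =
    if ⌊ compatible? (minmax P (l x)) (minmax P (r y)) ⌋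
    then (if ⌊ minmax P (l x) ⪯? minmax P (r y) ⌋
          then Maybe.map (l x ∷_) (merge P xs (y ∷ ys))
          else Maybe.map (r y ∷_) (merge P (x ∷ xs) ys))
    else nothing

  runsFrom : Partition → List UV → ℕ × ℕ → List UV → List (List UV)
  runsFrom P cur p [] = cur ∷ []
  runsFrom P cur p (w ∷ ws) with minmax P w ≟ₚ p
  ... | yes _ = runsFrom P (cur ∷ʳ w) p ws
  ... | no _ = cur ∷ runsFrom P (w ∷ []) (minmax P w) ws

  runs : Partition → List UV → List (List UV)
  runs P [] = []
  runs P (v ∷ vs) = runsFrom P (v ∷ []) (minmax P v) vs

  -- S₀ = P_i ∩ V₀ in increasing 𝒜₀-order, S₁ likewise
  refineBlock : Partition → List UV → Maybe (List (List UV))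
  refineBlock P B = Maybe.map (runs P)
    (merge P (filter (λ x → l x ∈? B) (allFin A₀.n)) (filter (λ y → r y ∈? B) (allFin A₁.n)))

  refineAll : Partition → List (List UV) → Maybe (List (List UV))
  refineAll P [] = just []
  refineAll P (B ∷ Bs) = refineBlock P B >>= λ rs → Maybe.map (rs ++_) (refineAll P Bs)

  step : Partition → Maybe Partition
  step [] = nothing
  step (P₀ ∷ Ps) = Maybe.map (P₀ ∷_) (refineAll (P₀ ∷ Ps) Ps)

  iterate : ℕ → Maybe Partition
  iterate zero = just initial
  iterate (suc t) = iterate t >>= step

  SamePartition : Partition → Partition → Set
  SamePartition = Pointwise _↭_

  -- the algorithm terminates without failure with final partition P:
  -- P is reached and a further step leaves the partition unchanged
  FinalPartition : Partition → Set
  FinalPartition P =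
    ∃[ t ] (iterate t ≡ just P × ∃[ Q ] (step P ≡ just Q × SamePartition Q P))

  module Quotient (P₀ : List UV) (Ps : List (List UV)) where
    P : Partition
    P = P₀ ∷ Ps

    EQ : Fin (length P) → Fin (length P) → Fin σ → Set
    EQ i j a = ∃[ v ] ∃[ v' ] (v ∈ lookup P i × v' ∈ lookup P j × (v , v' , a) ∈ edgesU)

    FQ : Fin (length P) → Set
    FQ i = ∃[ v ] (v ∈ lookup P i × finalU v ≡ true)

    LangQ : List (Fin σ) → Set
    LangQ w = Accepts EQ FQ fzero w

{-# OPTIONS --safe #-}
module Submission where

-- Every iterate of the refining algorithm is the block {s} followed by blocks of
-- non-start states that are disjoint, cover all non-start states, have a single
-- incoming label each, and respect the Wheeler order of each component automaton.
-- At the fixed point every block is homogeneous: its members share one minmax pair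
-- (ℓ, m), and m ≤ ℓ as soon as the block has two members -- for two states of the
-- same component by the Wheeler property of that component (sources of equally
-- labelled edges are ordered like their targets), for states of different
-- components by the compatibility enforced while merging. Hence all edges into such
-- a block come from the single block ℓ = m and carry a single label, so a run of 𝒰'
-- lifts backwards: every state of the current block is reachable in 𝒰 by the word
-- read so far. The other inclusion holds for any quotient.

open import Defs
open import Function.Bundles using (_⇔_; mk⇔)
open import Data.Nat using (ℕ; zero; suc; _≤_; _<_; _⊓_; _⊔_; z≤n; s≤s; _+_)
open import Data.Nat.Properties
  using (≤-refl; ≤-reflexive; <⇒≤; ≤-trans; <-irrefl; <-≤-trans; <-cmp; ≤-antisym; ≮⇒≥; m≤n⇒m<n∨m≡n;
         module ≤-Reasoning; m⊓n≤m; m⊓n≤n; m≤m⊔n; m≤n⊔m; ⊓-sel; ⊔-sel; m≤m+n; m+n≮m; ≤-pred; +-monoʳ-≤; +-cancelˡ-≤; +-cancelˡ-≡; suc-injective)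
open import Data.Fin as F using (Fin; toℕ) renaming (zero to fzero; suc to fsuc)
import Data.Fin.Properties as FP
open import Data.List using (List; []; _∷_; _++_; map; filter; lookup; length; concat; allFin; foldr)
open import Data.List.Membership.Propositional using (_∈_; _∉_; find; lose)
import Data.List.Membership.DecPropositional as DecMem
open import Data.List.Membership.Propositional.Properties
  using (∈-map⁺; ∈-map⁻; ∈-++⁺ˡ; ∈-++⁺ʳ; ∈-++⁻; ∈-filter⁺; ∈-filter⁻; ∈-allFin; ∈-concat⁺′; ∈-concat⁻′)
import Data.List.Properties as LP
open import Data.List.Relation.Unary.Any using (here; there; any?)
open import Data.List.Relation.Unary.All as All using (All; []; _∷_)
import Data.List.Relation.Unary.All.Properties as AllP
open import Data.List.Relation.Unary.AllPairs as AllPairs using (AllPairs; []; _∷_)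
import Data.List.Relation.Unary.AllPairs.Properties as AllPairsP
open import Data.List.Relation.Unary.Linked as Linked using (Linked; []; [-]; _∷_)
open import Data.List.Relation.Binary.Pointwise using (Pointwise; _∷_)
open import Data.List.Relation.Binary.Permutation.Propositional using (_↭_; ↭-sym)
open import Data.List.Relation.Binary.Permutation.Propositional.Properties using (∈-resp-↭)
open import Data.Product using (Σ; ∃; ∃₂; _×_; _,_; proj₁; proj₂)
open import Data.Maybe using (Maybe; just; nothing; maybe)
import Data.Maybe.Properties as MaybeP
open import Data.Sum using (_⊎_; inj₁; inj₂; swap; reduce)
open import Data.Empty using (⊥; ⊥-elim)
open import Data.Unit using (⊤; tt)
open import Relation.Nullary using (¬_; yes; no)
open import Level using (0ℓ)
open import Relation.Binary.Core using (Rel)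
open import Relation.Binary.Definitions using (tri<; tri≈; tri>)
open import Relation.Binary.PropositionalEquality
  using (_≡_; _≢_; refl; sym; trans; cong; subst)

foldr-⊓-≤ : ∀ x xs {k} → k ∈ x ∷ xs → foldr _⊓_ x xs ≤ k
foldr-⊓-≤ x []       (here refl)         = ≤-refl
foldr-⊓-≤ x (y ∷ xs) (here refl)         = ≤-trans (m⊓n≤n y _) (foldr-⊓-≤ x xs (here refl))
foldr-⊓-≤ x (y ∷ xs) (there (here refl)) = m⊓n≤m y _
foldr-⊓-≤ x (y ∷ xs) (there (there p))   = ≤-trans (m⊓n≤n y _) (foldr-⊓-≤ x xs (there p))

foldr-⊔-≥ : ∀ x xs {k} → k ∈ x ∷ xs → k ≤ foldr _⊔_ x xs
foldr-⊔-≥ x []       (here refl)         = ≤-refl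
foldr-⊔-≥ x (y ∷ xs) (here refl)         = ≤-trans (foldr-⊔-≥ x xs (here refl)) (m≤n⊔m y _)
foldr-⊔-≥ x (y ∷ xs) (there (here refl)) = m≤m⊔n y _
foldr-⊔-≥ x (y ∷ xs) (there (there p))   = ≤-trans (foldr-⊔-≥ x xs (there p)) (m≤n⊔m y _)

foldr-⊓-∈ : ∀ x xs → foldr _⊓_ x xs ∈ x ∷ xs
foldr-⊓-∈ x []       = here refl
foldr-⊓-∈ x (y ∷ xs) with ⊓-sel y (foldr _⊓_ x xs)
... | inj₁ e rewrite e = there (here refl)
... | inj₂ e rewrite e with foldr-⊓-∈ x xs
...   | here p  = here p
...   | there p = there (there p)

foldr-⊔-∈ : ∀ x xs → foldr _⊔_ x xs ∈ x ∷ xs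
foldr-⊔-∈ x []       = here refl
foldr-⊔-∈ x (y ∷ xs) with ⊔-sel y (foldr _⊔_ x xs)
... | inj₁ e rewrite e = there (here refl)
... | inj₂ e rewrite e with foldr-⊔-∈ x xs
...   | here p  = here p
...   | there p = there (there p)

module _ {A : Set} where

  AllPairs-++⁻ʳ : ∀ {R : Rel A 0ℓ} xs {ys} → AllPairs R (xs ++ ys) → AllPairs R ys
  AllPairs-++⁻ʳ []       rs       = rs
  AllPairs-++⁻ʳ (_ ∷ xs) (_ ∷ rs) = AllPairs-++⁻ʳ xs rs

  AllPairs-++⁻-across : ∀ {R : Rel A 0ℓ} xs {ys x y} → AllPairs R (xs ++ ys) →
                        x ∈ xs → y ∈ ys → R x y
  AllPairs-++⁻-across (_ ∷ xs) (r ∷ _)  (here refl) y∈ = All.lookup r (∈-++⁺ʳ xs y∈)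
  AllPairs-++⁻-across (_ ∷ xs) (_ ∷ rs) (there x∈)  y∈ = AllPairs-++⁻-across xs rs x∈ y∈

  Linked-++⁻ : ∀ {R : Rel A 0ℓ} xs {ys} → Linked R (xs ++ ys) → Linked R xs × Linked R ys
  Linked-++⁻ []            rs = [] , rs
  Linked-++⁻ (x ∷ [])      rs = [-] , Linked.tail rs
  Linked-++⁻ (x ∷ y ∷ xs)  (r ∷ rs) with Linked-++⁻ (y ∷ xs) rs
  ... | rxs , rys = r ∷ rxs , rys

  linked-switch : ∀ {B : Set} {R : Rel A 0ℓ} (f : A → B) {v w xs} →
                  Linked (λ a b → f a ≡ f b ⊎ R a b) (v ∷ xs) → w ∈ xs → f v ≢ f w →
                  ∃₂ λ a b → a ∈ v ∷ xs × b ∈ v ∷ xs × R a b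
  linked-switch f (inj₂ r ∷ _)  _           _  = _ , _ , here refl , there (here refl) , r
  linked-switch f (inj₁ e ∷ _)  (here refl) ne = ⊥-elim (ne e)
  linked-switch f (inj₁ e ∷ rs) (there w∈)  ne with linked-switch f rs w∈ (λ e′ → ne (trans e e′))
  ... | a , b , a∈ , b∈ , r = a , b , there a∈ , there b∈ , r

  linked-mixed : ∀ {B : Set} {R : Rel A 0ℓ} (f : A → B) {u w xs} →
                 Linked (λ a b → f a ≡ f b ⊎ R a b) xs → u ∈ xs → w ∈ xs → f u ≢ f w →
                 ∃₂ λ a b → a ∈ xs × b ∈ xs × R a b
  linked-mixed f rs (here refl) (here refl) ne = ⊥-elim (ne refl)
  linked-mixed f rs (here refl) (there w∈)  ne = linked-switch f rs w∈ ne
  linked-mixed f rs (there u∈)  (here refl) ne = linked-switch f rs u∈ (λ e → ne (sym e))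
  linked-mixed f rs (there u∈)  (there w∈)  ne with linked-mixed f (Linked.tail rs) u∈ w∈ ne
  ... | a , b , a∈ , b∈ , r = a , b , there a∈ , there b∈ , r

  data InBlock (v : A) : List (List A) → ℕ → Set where
    inHead : ∀ {X Xs}   → v ∈ X → InBlock v (X ∷ Xs) 0
    inTail : ∀ {X Xs k} → InBlock v Xs k → InBlock v (X ∷ Xs) (suc k)

  InBlock⇒∈concat : ∀ {v Xs k} → InBlock v Xs k → v ∈ concat Xs
  InBlock⇒∈concat (inHead p)          = ∈-++⁺ˡ p
  InBlock⇒∈concat {Xs = X ∷ _} (inTail q) = ∈-++⁺ʳ X (InBlock⇒∈concat q)

  InBlock-bound : ∀ {v Xs k} → InBlock v Xs k → k < length Xs
  InBlock-bound (inHead _) = s≤s z≤n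
  InBlock-bound (inTail q) = s≤s (InBlock-bound q)

  InBlock⇒lookup : ∀ {v Xs k} → InBlock v Xs k → Σ (Fin (length Xs)) λ i → v ∈ lookup Xs i × toℕ i ≡ k
  InBlock⇒lookup (inHead p) = fzero , p , refl
  InBlock⇒lookup (inTail q) with InBlock⇒lookup q
  ... | i , p , e = fsuc i , p , cong suc e

  InBlock⇒∈lookup : ∀ {v} Xs {i} → InBlock v Xs (toℕ i) → v ∈ lookup Xs i
  InBlock⇒∈lookup (X ∷ Xs) {fzero}  (inHead p) = p
  InBlock⇒∈lookup (X ∷ Xs) {fsuc i} (inTail q) = InBlock⇒∈lookup Xs q

  lookup⇒InBlock : ∀ {v} Xs i → v ∈ lookup Xs i → InBlock v Xs (toℕ i)
  lookup⇒InBlock (X ∷ Xs) fzero    p = inHead p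
  lookup⇒InBlock (X ∷ Xs) (fsuc i) p = inTail (lookup⇒InBlock Xs i p)

  InBlock-++⁻ : ∀ {v Ys k} Xs → InBlock v (Xs ++ Ys) k →
                InBlock v Xs k ⊎ ∃ λ k′ → k ≡ length Xs + k′ × InBlock v Ys k′
  InBlock-++⁻ []       q          = inj₂ (_ , refl , q)
  InBlock-++⁻ (X ∷ Xs) (inHead p) = inj₁ (inHead p)
  InBlock-++⁻ (X ∷ Xs) (inTail q) with InBlock-++⁻ Xs q
  ... | inj₁ q′                = inj₁ (inTail q′)
  ... | inj₂ (k′ , refl , q′)  = inj₂ (k′ , refl , q′)

  InBlock-same : ∀ {u v Xs k} → InBlock u Xs k → InBlock v Xs k → ∃ λ X → X ∈ Xs × u ∈ X × v ∈ X
  InBlock-same (inHead p) (inHead q) = _ , here refl , p , q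
  InBlock-same (inTail p) (inTail q) with InBlock-same p q
  ... | X , X∈ , u∈ , v∈ = X , there X∈ , u∈ , v∈

  AllPairs-concat-InBlock : ∀ {R : Rel A 0ℓ} {u v Xs i j} → AllPairs R (concat Xs) →
                            InBlock u Xs i → InBlock v Xs j → i < j → R u v
  AllPairs-concat-InBlock {Xs = X ∷ _} rs (inHead p) (inTail q) _ =
    AllPairs-++⁻-across X rs p (InBlock⇒∈concat q)
  AllPairs-concat-InBlock {Xs = X ∷ _} rs (inTail p) (inTail q) (s≤s i<j) =
    AllPairs-concat-InBlock (AllPairs-++⁻ʳ X rs) p q i<j

  BlocksDisjoint : List (List A) → Set
  BlocksDisjoint Xs = ∀ {v i j} → InBlock v Xs i → InBlock v Xs j → i ≡ j

  Graded : (A → ℕ) → List (List A) → Set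
  Graded κ []       = ⊤
  Graded κ (X ∷ Xs) = (∀ {u v} → u ∈ X → v ∈ concat Xs → κ u < κ v) ×
                      (∀ {u v} → u ∈ X → v ∈ X → κ u ≡ κ v) × Graded κ Xs

  Graded-< : ∀ {κ u v Xs i j} → Graded κ Xs → InBlock u Xs i → InBlock v Xs j → i < j → κ u < κ v
  Graded-< (lt , _ , _) (inHead p) (inTail q) _         = lt p (InBlock⇒∈concat q)
  Graded-< (_ , _ , g)  (inTail p) (inTail q) (s≤s i<j) = Graded-< g p q i<j

  Graded-≡ : ∀ {κ u v Xs k} → Graded κ Xs → InBlock u Xs k → InBlock v Xs k → κ u ≡ κ v
  Graded-≡ (_ , eq , _) (inHead p) (inHead q) = eq p q
  Graded-≡ (_ , _ , g)  (inTail p) (inTail q) = Graded-≡ g p q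

  Graded⇒BlocksDisjoint : ∀ {κ Xs} → Graded κ Xs → BlocksDisjoint Xs
  Graded⇒BlocksDisjoint {κ} g {v} {i} {j} p q with <-cmp i j
  ... | tri< i<j _ _ = ⊥-elim (<-irrefl refl (Graded-< g p q i<j))
  ... | tri≈ _ e _   = e
  ... | tri> _ _ j<i = ⊥-elim (<-irrefl refl (Graded-< g q p j<i))

  Graded-map : ∀ {n} {κ : A → ℕ} (F : Fin n → List A) → (∀ {c u} → u ∈ F c → κ u ≡ toℕ c) →
               ∀ {cs} → AllPairs F._<_ cs → Graded κ (map F cs)
  Graded-map F κF []         = tt
  Graded-map {κ = κ} F κF {c ∷ cs} (c< ∷ cs<) = earlier , same , Graded-map F κF cs<
    where
    earlier : ∀ {u v} → u ∈ F c → v ∈ concat (map F cs) → κ u < κ v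
    earlier u∈ v∈ with ∈-concat⁻′ (map F cs) v∈
    ... | X , v∈X , X∈ with ∈-map⁻ F X∈
    ...   | c′ , c′∈ , refl rewrite κF u∈ | κF v∈X = All.lookup c< c′∈
    same : ∀ {u v} → u ∈ F c → v ∈ F c → κ u ≡ κ v
    same u∈ v∈ = trans (κF u∈) (sym (κF v∈))

Path : ∀ {σ} {S : Set} → (S → S → Fin σ → Set) → S → List (Fin σ) → S → Set
Path E q w f = Accepts E (_≡ f) q w

Path-++ : ∀ {σ} {S : Set} {E : S → S → Fin σ → Set} {F : S → Set} {q f w w′} →
          Path E q w f → Accepts E F f w′ → Accepts E F q (w ++ w′)
Path-++ (acc-nil refl)   acc = acc
Path-++ (acc-cons e pth) acc = acc-cons e (Path-++ pth acc)

module UnionLanguage {σ : ℕ} (A₀ A₁ : WA σ)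
                     (W₀ : IsWheelerAutomaton A₀) (W₁ : IsWheelerAutomaton A₁) where
  open Union A₀ A₁
  open DecMem _≟ᵤ_ using (_∈?_)

  data Side : Set where
    left right : Side

  automaton : Side → WA σ
  automaton left  = A₀
  automaton right = A₁

  isWheeler : (b : Side) → IsWheelerAutomaton (automaton b)
  isWheeler left  = W₀
  isWheeler right = W₁

  wheelerGraph : (b : Side) → IsWheelerGraph (automaton b)
  wheelerGraph b = IsWheelerAutomaton.wheeler (isWheeler b)

  edgesOf : (b : Side) → List (Edge (suc (WA.n (automaton b))) σ)
  edgesOf b = WA.edges (automaton b)

  node : (b : Side) → Fin (WA.n (automaton b)) → UV
  node left  = l
  node right = r

  embed : (b : Side) → WA.State (automaton b) → UV
  embed left  = emb₀
  embed right = emb₁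

  embed-suc : ∀ b x → embed b (fsuc x) ≡ node b x
  embed-suc left  x = refl
  embed-suc right x = refl

  data View : UV → Set where
    start  : View s
    nodeOf : ∀ b x → View (node b x)

  view : ∀ v → View v
  view s     = start
  view (l x) = nodeOf left x
  view (r y) = nodeOf right y

  node≢s : ∀ {b x} → node b x ≢ s
  node≢s {left}  ()
  node≢s {right} ()

  side : UV → Maybe Side
  side s     = nothing
  side (l _) = just left
  side (r _) = just right

  ∈edgesU⁺ : ∀ b {q q′ a} → (q , q′ , a) ∈ edgesOf b → (embed b q , embed b q′ , a) ∈ edgesU
  ∈edgesU⁺ left  m = ∈-++⁺ˡ (∈-map⁺ (λ e → emb₀ (proj₁ e) , emb₀ (proj₁ (proj₂ e)) , proj₂ (proj₂ e)) m)
  ∈edgesU⁺ right m = ∈-++⁺ʳ _ (∈-map⁺ (λ e → emb₁ (proj₁ e) , emb₁ (proj₁ (proj₂ e)) , proj₂ (proj₂ e)) m)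

  ∈edgesU⁻ : ∀ {u v a} → (u , v , a) ∈ edgesU →
             Σ Side λ b → ∃₂ λ q q′ → (q , q′ , a) ∈ edgesOf b × u ≡ embed b q × v ≡ embed b q′
  ∈edgesU⁻ m with ∈-++⁻ (map _ (edgesOf left)) m
  ... | inj₁ m₀ with ∈-map⁻ (λ e → emb₀ (proj₁ e) , emb₀ (proj₁ (proj₂ e)) , proj₂ (proj₂ e)) m₀
  ...   | _ , e , refl = left , _ , _ , e , refl , refl
  ∈edgesU⁻ m | inj₂ m₁ with ∈-map⁻ (λ e → emb₁ (proj₁ e) , emb₁ (proj₁ (proj₂ e)) , proj₂ (proj₂ e)) m₁
  ...   | _ , e , refl = right , _ , _ , e , refl , refl

  no-edge-into-s : ∀ {u a} → ¬ (u , s , a) ∈ edgesU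
  no-edge-into-s m with ∈edgesU⁻ m
  ... | left  , q , fzero , e , _ , _ = IsWheelerAutomaton.start-indeg0 W₀ q _ e
  ... | right , q , fzero , e , _ , _ = IsWheelerAutomaton.start-indeg0 W₁ q _ e

  edge-into-node : ∀ b {u x a} → (u , node b x , a) ∈ edgesU →
                   ∃ λ q → (q , fsuc x , a) ∈ edgesOf b × u ≡ embed b q
  edge-into-node b m with ∈edgesU⁻ m
  edge-into-node left  _ | left  , q , fsuc _ , e , u≡ , refl = q , e , u≡
  edge-into-node right _ | right , q , fsuc _ , e , u≡ , refl = q , e , u≡
  edge-into-node left  _ | right , _ , fzero  , _ , _  , ()
  edge-into-node left  _ | right , _ , fsuc _ , _ , _  , ()
  edge-into-node right _ | left  , _ , fzero  , _ , _  , ()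
  edge-into-node right _ | left  , _ , fsuc _ , _ , _  , ()

  incoming-edge : ∀ v → v ≢ s → ∃₂ λ u a → (u , v , a) ∈ edgesU
  incoming-edge v v≢s with view v
  ... | start = ⊥-elim (v≢s refl)
  ... | nodeOf b x with any? (λ e → proj₁ (proj₂ e) FP.≟ fsuc x) (edgesOf b)
  ...   | yes p with find p
  ...     | (q , _ , a) , e , refl = embed b q , a , subst (λ w → (embed b q , w , a) ∈ edgesU) (embed-suc b x) (∈edgesU⁺ b e)
  incoming-edge v v≢s | nodeOf b x | no ¬p
    with IsWheelerAutomaton.only-indeg0 (isWheeler b) (fsuc x) (λ q a e → ¬p (lose e refl))
  ... | ()

  edges-into-same-label : ∀ {u u′ v a a′} → (u , v , a) ∈ edgesU → (u′ , v , a′) ∈ edgesU → a ≡ a′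
  edges-into-same-label {v = v} {a} {a′} m m′ with view v
  ... | start = ⊥-elim (no-edge-into-s m)
  ... | nodeOf b x with edge-into-node b m | edge-into-node b m′ | FP.<-cmp a a′
  ...   | _ , e , _ | _ , e′ , _ | tri< a<a′ _ _ =
          ⊥-elim (FP.<-irrefl refl (IsWheelerGraph.wheeler-label (wheelerGraph b) e e′ a<a′))
  ...   | _ , _ , _ | _ , _ , _  | tri≈ _ a≡a′ _ = a≡a′
  ...   | _ , e , _ | _ , e′ , _ | tri> _ _ a′<a =
          ⊥-elim (FP.<-irrefl refl (IsWheelerGraph.wheeler-label (wheelerGraph b) e′ e a′<a))

  ∈edgesInto⁺ : ∀ {u v a} → (u , v , a) ∈ edgesU → (u , v , a) ∈ edgesInto v
  ∈edgesInto⁺ {v = v} m = ∈-filter⁺ (λ e → proj₁ (proj₂ e) ≟ᵤ v) m refl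

  ∈edgesInto⁻ : ∀ {u v′ a v} → (u , v′ , a) ∈ edgesInto v → (u , v′ , a) ∈ edgesU × v′ ≡ v
  ∈edgesInto⁻ {v = v} m = ∈-filter⁻ (λ e → proj₁ (proj₂ e) ≟ᵤ v) m

  λᵤ-edge : ∀ {u v a} → (u , v , a) ∈ edgesU → λᵤ v ≡ just a
  λᵤ-edge {v = v} m with edgesInto v in eq
  ... | [] with subst (_ ∈_) eq (∈edgesInto⁺ m)
  ...   | ()
  λᵤ-edge {v = v} m | (u′ , v′ , a′) ∷ _ with ∈edgesInto⁻ {u′} {v′} {a′} {v} (subst ((u′ , v′ , a′) ∈_) (sym eq) (here refl))
  ...   | m′ , refl = cong just (edges-into-same-label m′ m)

  minBlock maxBlock : Partition → UV → ℕ
  minBlock P v = proj₁ (minmax P v)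
  maxBlock P v = proj₂ (minmax P v)

  sourceBlocks : Partition → UV → List ℕ
  sourceBlocks P v = map (λ e → blockOf P (proj₁ e)) (edgesInto v)

  ∈sourceBlocks⁺ : ∀ P {u v a} → (u , v , a) ∈ edgesU → blockOf P u ∈ sourceBlocks P v
  ∈sourceBlocks⁺ P m = ∈-map⁺ (λ e → blockOf P (proj₁ e)) (∈edgesInto⁺ m)

  minmax-bounds : ∀ P {u v a} → (u , v , a) ∈ edgesU →
                  minBlock P v ≤ blockOf P u × blockOf P u ≤ maxBlock P v
  minmax-bounds P {u} {v} m with sourceBlocks P v in eq
  ... | [] with subst (blockOf P u ∈_) eq (∈sourceBlocks⁺ P m)
  ...   | ()
  minmax-bounds P {u} {v} m | k ∷ ks =
    foldr-⊓-≤ k ks u∈ , foldr-⊔-≥ k ks u∈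
    where u∈ = subst (blockOf P u ∈_) eq (∈sourceBlocks⁺ P m)

  ∈sourceBlocks⁻ : ∀ P {v k} → k ∈ sourceBlocks P v →
                 ∃₂ λ u a → (u , v , a) ∈ edgesU × blockOf P u ≡ k
  ∈sourceBlocks⁻ P {v} k∈ with ∈-map⁻ (λ e → blockOf P (proj₁ e)) k∈
  ... | (u , v′ , a) , m , refl with ∈edgesInto⁻ {u} {v′} {a} {v} m
  ...   | m′ , refl = u , a , m′ , refl

  minBlock-attained : ∀ P v → v ≢ s → ∃₂ λ u a → (u , v , a) ∈ edgesU × blockOf P u ≡ minBlock P v
  minBlock-attained P v v≢s with sourceBlocks P v in eq
  ... | k ∷ ks = ∈sourceBlocks⁻ P (subst (_ ∈_) (sym eq) (foldr-⊓-∈ k ks))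
  ... | [] with incoming-edge v v≢s
  ...   | u , _ , m with subst (blockOf P u ∈_) eq (∈sourceBlocks⁺ P m)
  ...     | ()

  maxBlock-attained : ∀ P v → v ≢ s → ∃₂ λ u a → (u , v , a) ∈ edgesU × blockOf P u ≡ maxBlock P v
  maxBlock-attained P v v≢s with sourceBlocks P v in eq
  ... | k ∷ ks = ∈sourceBlocks⁻ P (subst (_ ∈_) (sym eq) (foldr-⊔-∈ k ks))
  ... | [] with incoming-edge v v≢s
  ...   | u , _ , m with subst (blockOf P u ∈_) eq (∈sourceBlocks⁺ P m)
  ...     | ()

  InBlock-blockOf : ∀ {v} Xs → v ∈ concat Xs → InBlock v Xs (blockOf Xs v)
  InBlock-blockOf {v} (X ∷ Xs) m with v ∈? X
  ... | yes p = inHead p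
  ... | no ¬p with ∈-++⁻ X m
  ...   | inj₁ p = ⊥-elim (¬p p)
  ...   | inj₂ q = inTail (InBlock-blockOf Xs q)

  blockOf-InBlock : ∀ {v Xs k} → BlocksDisjoint Xs → InBlock v Xs k → blockOf Xs v ≡ k
  blockOf-InBlock {Xs = Xs} disj p = disj (InBlock-blockOf Xs (InBlock⇒∈concat p)) p

  side-node : ∀ b x → side (node b x) ≡ just b
  side-node left  x = refl
  side-node right x = refl

  SideBefore : Side → UV → UV → Set
  SideBefore b u v = ∀ {x y} → u ≡ node b x → v ≡ node b y → x F.< y

  side-sorted-monotone : ∀ {b Xs x y i j} → AllPairs (SideBefore b) (concat Xs) → x F.< y →
                         InBlock (node b x) Xs i → InBlock (node b y) Xs j → i ≤ j
  side-sorted-monotone {i = i} {j} sorted x<y p q with <-cmp j i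
  ... | tri< j<i _ _ = ⊥-elim (FP.<-asym x<y (AllPairs-concat-InBlock sorted q p j<i refl refl))
  ... | tri≈ _ j≡i _ = ≤-reflexive (sym j≡i)
  ... | tri> _ _ i<j = <⇒≤ i<j

  side-sorted⇒BlocksDisjoint : ∀ {Xs} → s ∉ concat Xs → (∀ b → AllPairs (SideBefore b) (concat Xs)) →
                               BlocksDisjoint Xs
  side-sorted⇒BlocksDisjoint {Xs} s∉ sorted {v} {i} {j} p q with view v
  ... | start = ⊥-elim (s∉ (InBlock⇒∈concat p))
  ... | nodeOf b x with <-cmp i j
  ...   | tri< i<j _ _ = ⊥-elim (FP.<-irrefl refl (AllPairs-concat-InBlock (sorted b) p q i<j refl refl))
  ...   | tri≈ _ i≡j _ = i≡j
  ...   | tri> _ _ j<i = ⊥-elim (FP.<-irrefl refl (AllPairs-concat-InBlock (sorted b) q p j<i refl refl))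

  module Refinement (P : Partition) where

    mm : UV → ℕ × ℕ
    mm = minmax P

    MergeAdjacent : UV → UV → Set
    MergeAdjacent u v = side u ≡ side v ⊎ Compatible (mm u) (mm v)

    data Merges : List (Fin (WA.n A₀)) → List (Fin (WA.n A₁)) → List UV → Set where
      onlyRight : ∀ {ys} → Merges [] ys (map r ys)
      onlyLeft  : ∀ {x xs} → Merges (x ∷ xs) [] (map l (x ∷ xs))
      takeLeft  : ∀ {x xs y ys L} → Compatible (mm (l x)) (mm (r y)) →
                  Merges xs (y ∷ ys) L → Merges (x ∷ xs) (y ∷ ys) (l x ∷ L)
      takeRight : ∀ {x xs y ys L} → Compatible (mm (l x)) (mm (r y)) →
                  Merges (x ∷ xs) ys L → Merges (x ∷ xs) (y ∷ ys) (r y ∷ L)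

    merge⇒Merges : ∀ xs ys {L} → merge P xs ys ≡ just L → Merges xs ys L
    merge⇒Merges []       ys       refl = onlyRight
    merge⇒Merges (x ∷ xs) []       refl = onlyLeft
    merge⇒Merges (x ∷ xs) (y ∷ ys) eq with compatible? (mm (l x)) (mm (r y))
    ... | no _ with () ← eq
    ... | yes c with mm (l x) ⪯? mm (r y)
    ...   | yes _ with merge P xs (y ∷ ys) in e
    ...     | just L with refl ← eq = takeLeft c (merge⇒Merges xs (y ∷ ys) e)
    merge⇒Merges (x ∷ xs) (y ∷ ys) eq | yes c | no _ with merge P (x ∷ xs) ys in e
    ...     | just L with refl ← eq = takeRight c (merge⇒Merges (x ∷ xs) ys e)

    ∈-Merges⁻ : ∀ {xs ys L v} → Merges xs ys L → v ∈ L →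
                (∃ λ x → x ∈ xs × v ≡ l x) ⊎ (∃ λ y → y ∈ ys × v ≡ r y)
    ∈-Merges⁻ onlyRight m with ∈-map⁻ r m
    ... | y , y∈ , refl = inj₂ (y , y∈ , refl)
    ∈-Merges⁻ onlyLeft m with ∈-map⁻ l m
    ... | x , x∈ , refl = inj₁ (x , x∈ , refl)
    ∈-Merges⁻ (takeLeft _ _) (here refl) = inj₁ (_ , here refl , refl)
    ∈-Merges⁻ (takeLeft _ M) (there m) with ∈-Merges⁻ M m
    ... | inj₁ (x , x∈ , e) = inj₁ (x , there x∈ , e)
    ... | inj₂ (y , y∈ , e) = inj₂ (y , y∈ , e)
    ∈-Merges⁻ (takeRight _ _) (here refl) = inj₂ (_ , here refl , refl)
    ∈-Merges⁻ (takeRight _ M) (there m) with ∈-Merges⁻ M m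
    ... | inj₁ (x , x∈ , e) = inj₁ (x , x∈ , e)
    ... | inj₂ (y , y∈ , e) = inj₂ (y , there y∈ , e)

    ∈-Merges⁺ˡ : ∀ {xs ys L x} → Merges xs ys L → x ∈ xs → l x ∈ L
    ∈-Merges⁺ˡ onlyLeft        x∈          = ∈-map⁺ l x∈
    ∈-Merges⁺ˡ (takeLeft _ _)  (here refl) = here refl
    ∈-Merges⁺ˡ (takeLeft _ M)  (there x∈)  = there (∈-Merges⁺ˡ M x∈)
    ∈-Merges⁺ˡ (takeRight _ M) x∈          = there (∈-Merges⁺ˡ M x∈)

    ∈-Merges⁺ʳ : ∀ {xs ys L y} → Merges xs ys L → y ∈ ys → r y ∈ L
    ∈-Merges⁺ʳ onlyRight       y∈          = ∈-map⁺ r y∈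
    ∈-Merges⁺ʳ (takeLeft _ M)  y∈          = there (∈-Merges⁺ʳ M y∈)
    ∈-Merges⁺ʳ (takeRight _ _) (here refl) = here refl
    ∈-Merges⁺ʳ (takeRight _ M) (there y∈)  = there (∈-Merges⁺ʳ M y∈)

    node-map-sorted : ∀ b b′ {xs} → AllPairs F._<_ xs → AllPairs (SideBefore b′) (map (node b) xs)
    node-map-sorted b b′ xs< = AllPairsP.map⁺ (AllPairs.map (before b b′) xs<)
      where
      before : ∀ b b′ {x y} → x F.< y → SideBefore b′ (node b x) (node b y)
      before left  left  x<y refl refl = x<y
      before left  right _   ()   _
      before right left  _   ()   _
      before right right x<y refl refl = x<y

    left-first : ∀ b {x xs ys L} → All (x F.<_) xs → Merges xs ys L → All (SideBefore b (l x)) L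
    left-first b {x} x< M = All.tabulate λ w∈ → before b (∈-Merges⁻ M w∈)
      where
      before : ∀ b {w} → (∃ λ x′ → x′ ∈ _ × w ≡ l x′) ⊎ (∃ λ y → y ∈ _ × w ≡ r y) → SideBefore b (l x) w
      before left  (inj₁ (_ , x′∈ , refl)) refl refl = All.lookup x< x′∈
      before left  (inj₂ (_ , _ , refl))   refl ()
      before right _                       ()   _

    right-first : ∀ b {y xs ys L} → All (y F.<_) ys → Merges xs ys L → All (SideBefore b (r y)) L
    right-first b {y} y< M = All.tabulate λ w∈ → before b (∈-Merges⁻ M w∈)
      where
      before : ∀ b {w} → (∃ λ x → x ∈ _ × w ≡ l x) ⊎ (∃ λ y′ → y′ ∈ _ × w ≡ r y′) → SideBefore b (r y) w
      before right (inj₂ (_ , y′∈ , refl)) refl refl = All.lookup y< y′∈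
      before right (inj₁ (_ , _ , refl))   refl ()
      before left  _                       ()   _

    Merges-sorted : ∀ b {xs ys L} → AllPairs F._<_ xs → AllPairs F._<_ ys → Merges xs ys L →
                    AllPairs (SideBefore b) L
    Merges-sorted b _          ys<        onlyRight       = node-map-sorted right b ys<
    Merges-sorted b xs<        _          onlyLeft        = node-map-sorted left b xs<
    Merges-sorted b (x< ∷ xs<) ys<        (takeLeft _ M)  = left-first b x< M ∷ Merges-sorted b xs< ys< M
    Merges-sorted b xs<        (y< ∷ ys<) (takeRight _ M) = right-first b y< M ∷ Merges-sorted b xs< ys< M

    node-map-linked : ∀ b xs → Linked MergeAdjacent (map (node b) xs)
    node-map-linked b []           = []
    node-map-linked b (x ∷ [])     = [-]
    node-map-linked b (x ∷ y ∷ xs) =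
      inj₁ (trans (side-node b x) (sym (side-node b y))) ∷ node-map-linked b (y ∷ xs)

    Merges-linked : ∀ {xs ys L} → Merges xs ys L → Linked MergeAdjacent L
    Merges-linked (onlyRight {ys})     = node-map-linked right ys
    Merges-linked (onlyLeft {x} {xs})  = node-map-linked left (x ∷ xs)
    Merges-linked (takeLeft c M@onlyRight)        = inj₂ c ∷ Merges-linked M
    Merges-linked (takeLeft c M@(takeLeft _ _))   = inj₁ refl ∷ Merges-linked M
    Merges-linked (takeLeft c M@(takeRight _ _))  = inj₂ c ∷ Merges-linked M
    Merges-linked (takeRight c M@onlyLeft)        = inj₂ (swap c) ∷ Merges-linked M
    Merges-linked (takeRight c M@(takeLeft _ _))  = inj₂ (swap c) ∷ Merges-linked M
    Merges-linked (takeRight c M@(takeRight _ _)) = inj₁ refl ∷ Merges-linked M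

    runsFrom-concat : ∀ cur π ws → concat (runsFrom P cur π ws) ≡ cur ++ ws
    runsFrom-concat cur π []       = refl
    runsFrom-concat cur π (w ∷ ws) with mm w ≟ₚ π
    ... | yes _ = trans (runsFrom-concat (cur ++ w ∷ []) π ws) (LP.++-assoc cur (w ∷ []) ws)
    ... | no _  = cong (cur ++_) (runsFrom-concat (w ∷ []) (mm w) ws)

    runs-concat : ∀ L → concat (runs P L) ≡ L
    runs-concat []       = refl
    runs-concat (v ∷ vs) = runsFrom-concat (v ∷ []) (mm v) vs

    Uniform : List UV → Set
    Uniform R = ∃ λ π → All (λ w → mm w ≡ π) R

    runsFrom-uniform : ∀ cur π ws → All (λ w → mm w ≡ π) cur → All Uniform (runsFrom P cur π ws)
    runsFrom-uniform cur π []       u = (π , u) ∷ []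
    runsFrom-uniform cur π (w ∷ ws) u with mm w ≟ₚ π
    ... | yes e = runsFrom-uniform (cur ++ w ∷ []) π ws (AllP.++⁺ u (e ∷ []))
    ... | no _  = (π , u) ∷ runsFrom-uniform (w ∷ []) (mm w) ws (refl ∷ [])

    runs-uniform : ∀ L → All Uniform (runs P L)
    runs-uniform []       = []
    runs-uniform (v ∷ vs) = runsFrom-uniform (v ∷ []) (mm v) vs (refl ∷ [])

    runsFrom-linked : ∀ cur π ws → Linked MergeAdjacent (cur ++ ws) →
                      All (Linked MergeAdjacent) (runsFrom P cur π ws)
    runsFrom-linked cur π [] adj = proj₁ (Linked-++⁻ cur adj) ∷ []
    runsFrom-linked cur π (w ∷ ws) adj with mm w ≟ₚ π
    ... | yes _ = runsFrom-linked (cur ++ w ∷ []) π ws (subst (Linked _) (sym (LP.++-assoc cur (w ∷ []) ws)) adj)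
    ... | no _  = proj₁ (Linked-++⁻ cur adj) ∷ runsFrom-linked (w ∷ []) (mm w) ws (proj₂ (Linked-++⁻ cur adj))

    runs-linked : ∀ L → Linked MergeAdjacent L → All (Linked MergeAdjacent) (runs P L)
    runs-linked []       _   = []
    runs-linked (v ∷ vs) adj = runsFrom-linked (v ∷ []) (mm v) vs adj

    uniform-mixed : ∀ {π u v R} → All (λ w → mm w ≡ π) R → Linked MergeAdjacent R →
                    u ∈ R → v ∈ R → side u ≢ side v → Compatible π π
    uniform-mixed uni adj u∈ v∈ ne with linked-mixed side adj u∈ v∈ ne
    ... | a , b , a∈ , b∈ , c rewrite All.lookup uni a∈ | All.lookup uni b∈ = c

    -- for π = (ℓ , m), Compatible π π says m ≤ ℓ
    Homogeneous : List (List UV) → Set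
    Homogeneous Rs = ∀ {u v k} → InBlock u Rs k → InBlock v Rs k →
                     mm u ≡ mm v × (side u ≢ side v → Compatible (mm u) (mm u))

    record RefinesBlock (B : List UV) (rs : List (List UV)) : Set where
      field
        sound       : ∀ {v} → v ∈ concat rs → v ∈ B
        complete    : ∀ {v} → v ∈ B → v ≢ s → v ∈ concat rs
        sorted      : ∀ b → AllPairs (SideBefore b) (concat rs)
        homogeneous : Homogeneous rs

    refineBlock-refines : ∀ B {rs} → refineBlock P B ≡ just rs → RefinesBlock B rs
    refineBlock-refines B eq
      with merge P (filter (λ x → l x ∈? B) (allFin _)) (filter (λ y → r y ∈? B) (allFin _)) in e
    ... | just L with refl ← eq = record
      { sound       = λ v∈ → sound (∈L v∈)
      ; complete    = complete
      ; sorted      = λ b → subst (AllPairs _) (sym (runs-concat L)) (Merges-sorted b xs< ys< M)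
      ; homogeneous = homogeneous
      }
      where
      M = merge⇒Merges _ _ e
      xs< = AllPairsP.filter⁺ (λ x → l x ∈? B) (AllPairsP.tabulate⁺-< (λ i<j → i<j))
      ys< = AllPairsP.filter⁺ (λ y → r y ∈? B) (AllPairsP.tabulate⁺-< (λ i<j → i<j))
      ∈L : ∀ {v} → v ∈ concat (runs P L) → v ∈ L
      ∈L = subst (_ ∈_) (runs-concat L)
      sound : ∀ {v} → v ∈ L → v ∈ B
      sound v∈ with ∈-Merges⁻ M v∈
      ... | inj₁ (_ , x∈ , refl) = proj₂ (∈-filter⁻ (λ x → l x ∈? B) {xs = allFin _} x∈)
      ... | inj₂ (_ , y∈ , refl) = proj₂ (∈-filter⁻ (λ y → r y ∈? B) {xs = allFin _} y∈)
      complete : ∀ {v} → v ∈ B → v ≢ s → v ∈ concat (runs P L)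
      complete {v} v∈ v≢s with view v
      ... | start = ⊥-elim (v≢s refl)
      ... | nodeOf left  x = subst (_ ∈_) (sym (runs-concat L)) (∈-Merges⁺ˡ M (∈-filter⁺ (λ x → l x ∈? B) (∈-allFin x) v∈))
      ... | nodeOf right y = subst (_ ∈_) (sym (runs-concat L)) (∈-Merges⁺ʳ M (∈-filter⁺ (λ y → r y ∈? B) (∈-allFin y) v∈))
      homogeneous : Homogeneous (runs P L)
      homogeneous p q with InBlock-same p q
      ... | R , R∈ , u∈ , v∈ with All.lookup (runs-uniform L) R∈
      ...   | π , uni rewrite All.lookup uni u∈ | All.lookup uni v∈ =
              refl , uniform-mixed uni (All.lookup (runs-linked L (Merges-linked M)) R∈) u∈ v∈

    record Refines (Bs Rs : List (List UV)) : Set where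
      field
        sound          : ∀ {v} → v ∈ concat Rs → v ∈ concat Bs
        complete       : ∀ {v} → v ∈ concat Bs → v ∈ concat Rs
        disjoint       : BlocksDisjoint Rs
        reflects-order : ∀ {u v i j i′ j′} → InBlock u Bs i → InBlock v Bs j →
                         InBlock u Rs i′ → InBlock v Rs j′ → i′ ≤ j′ → i ≤ j
        sorted-within  : ∀ b {x y i i′ j′} → x F.< y →
                         InBlock (node b x) Bs i → InBlock (node b y) Bs i →
                         InBlock (node b x) Rs i′ → InBlock (node b y) Rs j′ → i′ ≤ j′
        homogeneous    : Homogeneous Rs

    module ConsRefinement {B Bs rs Rs′} (disj : BlocksDisjoint (B ∷ Bs)) (s∉ : s ∉ concat (B ∷ Bs))
                          (head : RefinesBlock B rs) (tail : Refines Bs Rs′) where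
      module H = RefinesBlock head
      module T = Refines tail
      n = length rs

      concat-split : concat (rs ++ Rs′) ≡ concat rs ++ concat Rs′
      concat-split = sym (LP.concat-++ rs Rs′)

      sound : ∀ {v} → v ∈ concat (rs ++ Rs′) → v ∈ B ++ concat Bs
      sound m with ∈-++⁻ (concat rs) (subst (_ ∈_) concat-split m)
      ... | inj₁ p = ∈-++⁺ˡ (H.sound p)
      ... | inj₂ q = ∈-++⁺ʳ B (T.sound q)

      complete : ∀ {v} → v ∈ B ++ concat Bs → v ∈ concat (rs ++ Rs′)
      complete m with ∈-++⁻ B m
      ... | inj₁ p = subst (_ ∈_) (sym concat-split) (∈-++⁺ˡ (H.complete p λ { refl → s∉ m }))
      ... | inj₂ q = subst (_ ∈_) (sym concat-split) (∈-++⁺ʳ (concat rs) (T.complete q))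

      not-both : ∀ {v} → v ∈ B → v ∈ concat Bs → ⊥
      not-both p q with disj (inHead p) (inTail (InBlock-blockOf Bs q))
      ... | ()

      new-in-head : ∀ {v k} → v ∈ B → InBlock v (rs ++ Rs′) k → InBlock v rs k
      new-in-head v∈B p with InBlock-++⁻ rs p
      ... | inj₁ p′ = p′
      ... | inj₂ (_ , _ , q) = ⊥-elim (not-both v∈B (T.sound (InBlock⇒∈concat q)))

      new-in-tail : ∀ {v k} → v ∈ concat Bs → InBlock v (rs ++ Rs′) k →
                    ∃ λ k′ → k ≡ n + k′ × InBlock v Rs′ k′
      new-in-tail v∈Bs p with InBlock-++⁻ rs p
      ... | inj₁ p′ = ⊥-elim (not-both (H.sound (InBlock⇒∈concat p′)) v∈Bs)
      ... | inj₂ q  = q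

      disjoint : BlocksDisjoint (rs ++ Rs′)
      disjoint p q with InBlock-++⁻ rs p | InBlock-++⁻ rs q
      ... | inj₁ p′ | inj₁ q′ =
            side-sorted⇒BlocksDisjoint (λ m → s∉ (∈-++⁺ˡ (H.sound m))) H.sorted p′ q′
      ... | inj₁ p′ | inj₂ (_ , _ , q′) =
            ⊥-elim (not-both (H.sound (InBlock⇒∈concat p′)) (T.sound (InBlock⇒∈concat q′)))
      ... | inj₂ (_ , _ , p′) | inj₁ q′ =
            ⊥-elim (not-both (H.sound (InBlock⇒∈concat q′)) (T.sound (InBlock⇒∈concat p′)))
      ... | inj₂ (_ , refl , p′) | inj₂ (_ , refl , q′) = cong (n +_) (T.disjoint p′ q′)

      reflects-order : ∀ {u v i j i′ j′} → InBlock u (B ∷ Bs) i → InBlock v (B ∷ Bs) j →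
                       InBlock u (rs ++ Rs′) i′ → InBlock v (rs ++ Rs′) j′ → i′ ≤ j′ → i ≤ j
      reflects-order (inHead _) _ _ _ _ = z≤n
      reflects-order (inTail pu) (inHead v∈B) p q i′≤j′
        with new-in-tail (InBlock⇒∈concat pu) p
      ... | i″ , refl , _ = ⊥-elim (<-irrefl refl
              (<-≤-trans (InBlock-bound (new-in-head v∈B q)) (≤-trans (m≤m+n n i″) i′≤j′)))
      reflects-order (inTail pu) (inTail pv) p q i′≤j′
        with new-in-tail (InBlock⇒∈concat pu) p | new-in-tail (InBlock⇒∈concat pv) q
      ... | i″ , refl , p′ | j″ , refl , q′ = s≤s (T.reflects-order pu pv p′ q′ (+-cancelˡ-≤ n i″ j″ i′≤j′))

      sorted-within : ∀ b {x y i i′ j′} → x F.< y →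
                      InBlock (node b x) (B ∷ Bs) i → InBlock (node b y) (B ∷ Bs) i →
                      InBlock (node b x) (rs ++ Rs′) i′ → InBlock (node b y) (rs ++ Rs′) j′ → i′ ≤ j′
      sorted-within b x<y (inHead x∈B) (inHead y∈B) p q =
        side-sorted-monotone (H.sorted b) x<y (new-in-head x∈B p) (new-in-head y∈B q)
      sorted-within b x<y (inTail px) (inTail py) p q
        with new-in-tail (InBlock⇒∈concat px) p | new-in-tail (InBlock⇒∈concat py) q
      ... | i″ , refl , p′ | j″ , refl , q′ = +-monoʳ-≤ n (T.sorted-within b x<y px py p′ q′)

      homogeneous : Homogeneous (rs ++ Rs′)
      homogeneous p q with InBlock-++⁻ rs p | InBlock-++⁻ rs q
      ... | inj₁ p′ | inj₁ q′ = H.homogeneous p′ q′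
      ... | inj₁ p′ | inj₂ (k , refl , _) = ⊥-elim (m+n≮m n k (InBlock-bound p′))
      ... | inj₂ (k , refl , _) | inj₁ q′ = ⊥-elim (m+n≮m n k (InBlock-bound q′))
      ... | inj₂ (k , refl , p′) | inj₂ (k′ , e , q′) with +-cancelˡ-≡ n k k′ e
      ...   | refl = T.homogeneous p′ q′

      refines : Refines (B ∷ Bs) (rs ++ Rs′)
      refines = record
        { sound = sound ; complete = complete ; disjoint = disjoint ; reflects-order = reflects-order
        ; sorted-within = sorted-within ; homogeneous = homogeneous }

    refineAll-refines : ∀ Bs {Rs} → BlocksDisjoint Bs → s ∉ concat Bs → refineAll P Bs ≡ just Rs →
                        Refines Bs Rs
    refineAll-refines [] _ _ refl = record
      { sound = λ () ; complete = λ () ; disjoint = λ () ; reflects-order = λ ()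
      ; sorted-within = λ _ _ () ; homogeneous = λ () }
    refineAll-refines (B ∷ Bs) disj s∉ eq with refineBlock P B in e₁ | refineAll P Bs in e₂
    ... | just rs | just Rs′ with refl ← eq =
      ConsRefinement.refines disj s∉ (refineBlock-refines B e₁)
        (refineAll-refines Bs (λ p q → suc-injective (disj (inTail p) (inTail q))) (λ m → s∉ (∈-++⁺ʳ B m)) e₂)

  record ValidBlocks (Bs : List (List UV)) : Set where
    field
      s∉            : s ∉ concat Bs
      covers        : ∀ v → v ≢ s → v ∈ concat Bs
      disjoint      : BlocksDisjoint Bs
      label-uniform : ∀ {u v k} → InBlock u Bs k → InBlock v Bs k → λᵤ u ≡ λᵤ v
      side-monotone : ∀ b {x y i j} → x F.< y →
                      InBlock (node b x) Bs i → InBlock (node b y) Bs j → i ≤ j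

  refineAll-valid : ∀ P {Bs Rs} → ValidBlocks Bs → refineAll P Bs ≡ just Rs → ValidBlocks Rs
  refineAll-valid P {Bs} {Rs} valid eq = record
    { s∉            = λ m → V.s∉ (R.sound m)
    ; covers        = λ v v≢s → R.complete (V.covers v v≢s)
    ; disjoint      = R.disjoint
    ; label-uniform = label-uniform
    ; side-monotone = side-monotone
    }
    where
    module V = ValidBlocks valid
    module R = Refinement.Refines (Refinement.refineAll-refines P Bs V.disjoint V.s∉ eq)

    old : ∀ {v k} → InBlock v Rs k → InBlock v Bs (blockOf Bs v)
    old p = InBlock-blockOf Bs (R.sound (InBlock⇒∈concat p))

    label-uniform : ∀ {u v k} → InBlock u Rs k → InBlock v Rs k → λᵤ u ≡ λᵤ v
    label-uniform p q with ≤-antisym (R.reflects-order (old p) (old q) p q ≤-refl)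
                                     (R.reflects-order (old q) (old p) q p ≤-refl)
    ... | same = V.label-uniform (old p) (subst (InBlock _ Bs) (sym same) (old q))

    side-monotone : ∀ b {x y i′ j′} → x F.< y →
                    InBlock (node b x) Rs i′ → InBlock (node b y) Rs j′ → i′ ≤ j′
    side-monotone b x<y p q with m≤n⇒m<n∨m≡n (V.side-monotone b x<y (old p) (old q))
    ... | inj₂ same = R.sorted-within b x<y (old p) (subst (InBlock _ Bs) (sym same) (old q)) p q
    ... | inj₁ i<j  = ≮⇒≥ λ j′<i′ → <-irrefl refl
                        (<-≤-trans i<j (R.reflects-order (old q) (old p) q p (<⇒≤ j′<i′)))

  concat-dropEmpty : ∀ Xs → concat (dropEmpty Xs) ≡ concat Xs
  concat-dropEmpty []             = refl
  concat-dropEmpty ([] ∷ Xs)      = concat-dropEmpty Xs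
  concat-dropEmpty ((x ∷ X) ∷ Xs) = cong ((x ∷ X) ++_) (concat-dropEmpty Xs)

  Graded-dropEmpty : ∀ {κ} Xs → Graded κ Xs → Graded κ (dropEmpty Xs)
  Graded-dropEmpty []             _             = tt
  Graded-dropEmpty ([] ∷ Xs)      (_ , _ , g)   = Graded-dropEmpty Xs g
  Graded-dropEmpty ((x ∷ X) ∷ Xs) (lt , eq , g) =
    (λ u∈ v∈ → lt u∈ (subst (_ ∈_) (concat-dropEmpty Xs) v∈)) , eq , Graded-dropEmpty Xs g

  labelBlock : Fin σ → List UV
  labelBlock c = filter (λ v → MaybeP.≡-dec FP._≟_ (λᵤ v) (just c)) nonStart

  initialBlocks : List (List UV)
  initialBlocks = dropEmpty (map labelBlock (allFin σ))

  -- the junk value 0 is taken only at s, which lies in no initial block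
  labelIndex : UV → ℕ
  labelIndex v = maybe toℕ 0 (λᵤ v)

  labelIndex-edge : ∀ {u v a} → (u , v , a) ∈ edgesU → labelIndex v ≡ toℕ a
  labelIndex-edge m = cong (maybe toℕ 0) (λᵤ-edge m)

  ∈labelBlock⁻ : ∀ {v c} → v ∈ labelBlock c → v ∈ nonStart × λᵤ v ≡ just c
  ∈labelBlock⁻ {c = c} = ∈-filter⁻ (λ v → MaybeP.≡-dec FP._≟_ (λᵤ v) (just c)) {xs = nonStart}

  ∈initialBlocks⁻ : ∀ {v} → v ∈ concat initialBlocks → ∃ λ c → v ∈ nonStart × λᵤ v ≡ just c
  ∈initialBlocks⁻ m
    with ∈-concat⁻′ (map labelBlock (allFin σ)) (subst (_ ∈_) (concat-dropEmpty (map labelBlock (allFin σ))) m)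
  ... | X , v∈X , X∈ with ∈-map⁻ labelBlock X∈
  ...   | c , _ , refl = c , ∈labelBlock⁻ v∈X

  s∉nonStart : s ∉ nonStart
  s∉nonStart m with ∈-++⁻ (map l (allFin (WA.n A₀))) m
  ... | inj₁ p with ∈-map⁻ l p
  ...   | _ , _ , ()
  s∉nonStart m | inj₂ p with ∈-map⁻ r p
  ...   | _ , _ , ()

  ∈nonStart : ∀ v → v ≢ s → v ∈ nonStart
  ∈nonStart s     v≢s = ⊥-elim (v≢s refl)
  ∈nonStart (l x) _   = ∈-++⁺ˡ (∈-map⁺ l (∈-allFin x))
  ∈nonStart (r y) _   = ∈-++⁺ʳ (map l (allFin (WA.n A₀))) (∈-map⁺ r (∈-allFin y))

  labelIndex-monotone : ∀ b {x y} → x F.< y → labelIndex (node b x) ≤ labelIndex (node b y)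
  labelIndex-monotone b {x} {y} x<y
    with incoming-edge (node b x) node≢s | incoming-edge (node b y) node≢s
  ... | _ , a , m | _ , a′ , m′ rewrite labelIndex-edge m | labelIndex-edge m′ = ≮⇒≥ λ a′<a →
        FP.<-asym x<y (≤-pred (IsWheelerGraph.wheeler-label (wheelerGraph b)
                                 (proj₁ (proj₂ (edge-into-node b m′))) (proj₁ (proj₂ (edge-into-node b m))) a′<a))

  initialBlocks-graded : Graded labelIndex initialBlocks
  initialBlocks-graded = Graded-dropEmpty (map labelBlock (allFin σ))
    (Graded-map labelBlock (λ m → cong (maybe toℕ 0) (proj₂ (∈labelBlock⁻ m)))
                (AllPairsP.tabulate⁺-< (λ i<j → i<j)))

  initialBlocks-valid : ValidBlocks initialBlocks
  initialBlocks-valid = record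
    { s∉            = λ m → s∉nonStart (proj₁ (proj₂ (∈initialBlocks⁻ m)))
    ; covers        = covers
    ; disjoint      = Graded⇒BlocksDisjoint initialBlocks-graded
    ; label-uniform = label-uniform
    ; side-monotone = λ b x<y p q → ≮⇒≥ λ j<i → <-irrefl refl
        (<-≤-trans (Graded-< initialBlocks-graded q p j<i) (labelIndex-monotone b x<y))
    }
    where
    covers : ∀ v → v ≢ s → v ∈ concat initialBlocks
    covers v v≢s with incoming-edge v v≢s
    ... | _ , a , m = subst (_ ∈_) (sym (concat-dropEmpty (map labelBlock (allFin σ))))
          (∈-concat⁺′ (∈-filter⁺ (λ v → MaybeP.≡-dec FP._≟_ (λᵤ v) (just a)) (∈nonStart v v≢s) (λᵤ-edge m))
                      (∈-map⁺ labelBlock (∈-allFin a)))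
    label-uniform : ∀ {u v k} → InBlock u initialBlocks k → InBlock v initialBlocks k → λᵤ u ≡ λᵤ v
    label-uniform p q with ∈initialBlocks⁻ (InBlock⇒∈concat p) | ∈initialBlocks⁻ (InBlock⇒∈concat q)
                         | Graded-≡ initialBlocks-graded p q
    ... | c , _ , eu | c′ , _ , ev | same rewrite eu | ev = cong just (FP.toℕ-injective same)

  iterate-valid : ∀ t {Q} → iterate t ≡ just Q → ∃ λ Bs → Q ≡ (s ∷ []) ∷ Bs × ValidBlocks Bs
  iterate-valid zero    refl = initialBlocks , refl , initialBlocks-valid
  iterate-valid (suc t) eq with iterate t in e
  ... | just Q′ with iterate-valid t e
  ...   | Bs , refl , valid with refineAll ((s ∷ []) ∷ Bs) Bs in e′
  ...     | just Rs with refl ← eq = Rs , refl , refineAll-valid _ valid e′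

  embed-zero : ∀ b → embed b fzero ≡ s
  embed-zero left  = refl
  embed-zero right = refl

  module Fixpoint (Bs : List (List UV)) (valid : ValidBlocks Bs) {Rs : List (List UV)}
                  (refined : refineAll ((s ∷ []) ∷ Bs) Bs ≡ just Rs) (unchanged : Pointwise _↭_ Rs Bs) where
    P : Partition
    P = (s ∷ []) ∷ Bs

    open Refinement P
    module V = ValidBlocks valid
    module R = Refines (refineAll-refines Bs V.disjoint V.s∉ refined)

    homogeneous : Homogeneous Bs
    homogeneous p q = R.homogeneous (same-position unchanged p) (same-position unchanged q)
      where
      same-position : ∀ {v Xs Ys k} → Pointwise _↭_ Ys Xs → InBlock v Xs k → InBlock v Ys k
      same-position (Y↭X ∷ _) (inHead p) = inHead (∈-resp-↭ (↭-sym Y↭X) p)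
      same-position (_ ∷ pw)  (inTail q) = inTail (same-position pw q)

    P-disjoint : BlocksDisjoint P
    P-disjoint (inHead (here refl)) (inHead _)          = refl
    P-disjoint (inTail p)           (inTail q)          = cong suc (V.disjoint p q)
    P-disjoint (inHead (here refl)) (inTail q)          = ⊥-elim (V.s∉ (InBlock⇒∈concat q))
    P-disjoint (inTail p)           (inHead (here refl)) = ⊥-elim (V.s∉ (InBlock⇒∈concat p))

    P-covers : ∀ v → v ∈ concat P
    P-covers v with v ≟ᵤ s
    ... | yes refl = here refl
    ... | no v≢s   = ∈-++⁺ʳ (s ∷ []) (V.covers v v≢s)

    P-position : ∀ v → InBlock v P (blockOf P v)
    P-position v = InBlock-blockOf P (P-covers v)

    node-position : ∀ {b} x → InBlock (node b x) Bs (blockOf Bs (node b x))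
    node-position x = InBlock-blockOf Bs (V.covers _ node≢s)

    embed-monotone : ∀ b {q q′} → q F.≤ q′ → blockOf P (embed b q) ≤ blockOf P (embed b q′)
    embed-monotone b {fzero} _ rewrite embed-zero b | blockOf-InBlock P-disjoint (inHead {Xs = Bs} (here refl)) = z≤n
    embed-monotone b {fsuc x} {fsuc y} x≤y
      rewrite embed-suc b x | embed-suc b y
            | blockOf-InBlock P-disjoint (inTail (node-position x))
            | blockOf-InBlock P-disjoint (inTail (node-position y))
      with FP.<-cmp x y
    ... | tri< x<y _ _  = s≤s (V.side-monotone b x<y (node-position x) (node-position y))
    ... | tri≈ _ refl _ = ≤-refl
    ... | tri> _ _ y<x  = ⊥-elim (<-irrefl refl (<-≤-trans y<x (≤-pred x≤y)))

    same-side-closed : ∀ b {x y} → x F.< y → mm (node b x) ≡ mm (node b y) →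
                       λᵤ (node b x) ≡ λᵤ (node b y) → maxBlock P (node b x) ≤ minBlock P (node b x)
    same-side-closed b {x} {y} x<y mm≡ λ≡
      with maxBlock-attained P (node b x) node≢s | minBlock-attained P (node b y) node≢s
    ... | _ , a , m , bm | _ , a′ , m′ , bm′ with edge-into-node b m | edge-into-node b m′
    ...   | q , e , refl | q′ , e′ , refl = begin
            maxBlock P (node b x)  ≡⟨ sym bm ⟩
            blockOf P (embed b q)  ≤⟨ embed-monotone b (≮⇒≥ q′≮q) ⟩
            blockOf P (embed b q′) ≡⟨ bm′ ⟩
            minBlock P (node b y)  ≡⟨ cong proj₁ (sym mm≡) ⟩
            minBlock P (node b x)  ∎
      where
      open ≤-Reasoning
      a≡a′ : a ≡ a′
      a≡a′ = MaybeP.just-injective (trans (sym (λᵤ-edge m)) (trans λ≡ (λᵤ-edge m′)))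
      q′≮q : ¬ q′ F.< q
      q′≮q q′<q = <-irrefl refl (<-≤-trans x<y (≤-pred
        (IsWheelerGraph.wheeler-source (wheelerGraph b) e′ (subst (λ c → (q , fsuc x , c) ∈ edgesOf b) a≡a′ e) q′<q)))

    same-side-block-closed : ∀ b {x y k} → InBlock (node b x) Bs k → InBlock (node b y) Bs k → x ≢ y →
                             mm (node b x) ≡ mm (node b y) → maxBlock P (node b x) ≤ minBlock P (node b x)
    same-side-block-closed b {x} {y} p q x≢y mm≡ with FP.<-cmp x y
    ... | tri< x<y _ _  = same-side-closed b x<y mm≡ (V.label-uniform p q)
    ... | tri≈ _ x≡y _  = ⊥-elim (x≢y x≡y)
    ... | tri> _ _ y<x rewrite mm≡ = same-side-closed b y<x (sym mm≡) (V.label-uniform q p)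

    block-closed : ∀ {u v k} → InBlock u Bs k → InBlock v Bs k → u ≢ v →
                   mm u ≡ mm v × maxBlock P u ≤ minBlock P u
    block-closed {u} {v} p q u≢v with view u | view v | homogeneous p q
    ... | start          | _              | _          = ⊥-elim (V.s∉ (InBlock⇒∈concat p))
    ... | nodeOf _ _     | start          | _          = ⊥-elim (V.s∉ (InBlock⇒∈concat q))
    ... | nodeOf left _  | nodeOf right _ | mm≡ , mixed = mm≡ , reduce (mixed λ ())
    ... | nodeOf right _ | nodeOf left _  | mm≡ , mixed = mm≡ , reduce (mixed λ ())
    ... | nodeOf left _  | nodeOf left _  | mm≡ , _    =
          mm≡ , same-side-block-closed left p q (λ e → u≢v (cong l e)) mm≡
    ... | nodeOf right _ | nodeOf right _ | mm≡ , _    =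
          mm≡ , same-side-block-closed right p q (λ e → u≢v (cong r e)) mm≡

    predecessor-closed : ∀ {i j v v′ u a} → InBlock v P i → InBlock v′ P j → (v , v′ , a) ∈ edgesU →
                         InBlock u P j → ∃ λ p → InBlock p P i × (p , u , a) ∈ edgesU
    predecessor-closed _ (inHead (here refl)) e _ = ⊥-elim (no-edge-into-s e)
    predecessor-closed {i} {v = v} {v′} {u} {a} pv (inTail q′) e (inTail q) with u ≟ᵤ v′
    ... | yes refl = v , pv , e
    ... | no u≢v′ with block-closed q q′ u≢v′ | incoming-edge u (λ { refl → V.s∉ (InBlock⇒∈concat q) })
    ...   | mm≡ , closed | p , a′ , e′ =
            p , subst (InBlock p P) p-in-i (P-position p) , subst (λ c → (p , u , c) ∈ edgesU) a′≡a e′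
      where
      a′≡a : a′ ≡ a
      a′≡a = MaybeP.just-injective (trans (sym (λᵤ-edge e′)) (trans (V.label-uniform q q′) (λᵤ-edge e)))
      open ≤-Reasoning
      p-in-i : blockOf P p ≡ i
      p-in-i = trans (≤-antisym
        (begin
          blockOf P p  ≤⟨ proj₂ (minmax-bounds P e′) ⟩
          maxBlock P u ≤⟨ closed ⟩
          minBlock P u ≡⟨ cong proj₁ mm≡ ⟩
          minBlock P v′ ≤⟨ proj₁ (minmax-bounds P e) ⟩
          blockOf P v ∎)
        (begin
          blockOf P v   ≤⟨ proj₂ (minmax-bounds P e) ⟩
          maxBlock P v′ ≡⟨ cong proj₂ (sym mm≡) ⟩
          maxBlock P u  ≤⟨ closed ⟩
          minBlock P u  ≤⟨ proj₁ (minmax-bounds P e′) ⟩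
          blockOf P p ∎))
        (blockOf-InBlock P-disjoint pv)

    open Quotient (s ∷ []) Bs using (EQ; FQ; LangQ)

    accepted⇒quotient : ∀ {q w} i → q ∈ lookup P i → Accepts EU FU q w → Accepts EQ FQ i w
    accepted⇒quotient i q∈ (acc-nil fin) = acc-nil (_ , q∈ , fin)
    accepted⇒quotient i q∈ (acc-cons {q' = q′} e acc) with InBlock⇒lookup (P-position q′)
    ... | j , q′∈ , _ = acc-cons (_ , _ , q∈ , q′∈ , e) (accepted⇒quotient j q′∈ acc)

    quotient⇒accepted : ∀ {i w} pre → (∀ {u} → u ∈ lookup P i → Path EU s pre u) →
                        Accepts EQ FQ i w → LangU (pre ++ w)
    quotient⇒accepted pre reach (acc-nil (_ , f∈ , fin)) = Path-++ (reach f∈) (acc-nil fin)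
    quotient⇒accepted {i} pre reach (acc-cons {q' = j} {a} {w} (_ , _ , v∈ , v′∈ , e) acc) =
      subst LangU (LP.++-assoc pre (a ∷ []) w) (quotient⇒accepted (pre ++ a ∷ []) reach′ acc)
      where
      reach′ : ∀ {u} → u ∈ lookup P j → Path EU s (pre ++ a ∷ []) u
      reach′ u∈ with predecessor-closed (lookup⇒InBlock P i v∈) (lookup⇒InBlock P j v′∈) e
                                        (lookup⇒InBlock P j u∈)
      ... | _ , p∈ , e′ = Path-++ (reach (InBlock⇒∈lookup P p∈)) (acc-cons e′ (acc-nil refl))

    language-equivalence : ∀ w → LangU w ⇔ LangQ w
    language-equivalence w = mk⇔ (accepted⇒quotient fzero (here refl))
                                 (quotient⇒accepted [] λ { (here refl) → acc-nil refl })

lemma11 : ∀ {σ} (A₀ A₁ : WA σ) → IsWheelerAutomaton A₀ → IsWheelerAutomaton A₁ →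
          (P₀ : List (Union.UV A₀ A₁)) (Ps : List (List (Union.UV A₀ A₁))) →
          Union.FinalPartition A₀ A₁ (P₀ ∷ Ps) →
          (w : List (Fin σ)) → Union.LangU A₀ A₁ w ⇔ Union.Quotient.LangQ A₀ A₁ P₀ Ps w
lemma11 A₀ A₁ W₀ W₁ P₀ Ps (t , reached , Q , stepped , same) w
  with UnionLanguage.iterate-valid A₀ A₁ W₀ W₁ t reached
... | Bs , refl , valid with Union.refineAll A₀ A₁ ((Union.s ∷ []) ∷ Bs) Bs in refined
... | just Rs with refl ← stepped with _ ∷ unchanged ← same =
  UnionLanguage.Fixpoint.language-equivalence A₀ A₁ W₀ W₁ Bs valid refined unchanged w
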